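{- Let $w$ be an involution of size $n$. Its inversion sequence $I(w)$ is slow-climbing if and only if $I(w)$ is a concatenation of slowly increasing sequences.
   Context: For $w\in S_n$ (one-line notation), its inversion sequence is $I(w)=(x_1,\ldots,x_n)$ with $x_i=\#\{j<i : w^{ -1}(j)>w^{ -1}(i)\}$. The slowly increasing sequence of size $m$ is $(0,1,2,\ldots,m-1)$. For an inversion sequence $x=(x_1,\ldots,x_n)$, an index $i$ is an ascent if $x_i<x_{i+1}$; it is a small ascent if $x_{i+1}=x_i+1$ and a large ascent otherwise. The sequence $x$ is slow-climbing if it has no large ascents. -}

module Defs where

open import Data.Nat using (ℕ; zero; suc; _<_)
open import Data.Fin using (Fin; toℕ; _<?_)
open import Data.Fin.Permutation using (Permutation′; _⟨$⟩ʳ_; _⟨$⟩ˡ_)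
open import Data.List using (List; []; _∷_; map; filter; length; concat; upTo; allFin)
open import Data.Product using (∃; _×_)
open import Relation.Binary.PropositionalEquality using (_≡_)
open import Relation.Nullary using (¬_)
open import Relation.Unary using (Pred)
open import Data.List.Relation.Unary.All using (All)

-- Permutations of [n] are modelled as permutations of Fin n = {0,…,n-1}
-- (values shifted down by 1; this does not affect inversion counts).

IsInvolution : ∀ {n} → Permutation′ n → Set
IsInvolution {n} w = ∀ (i : Fin n) → w ⟨$⟩ʳ (w ⟨$⟩ʳ i) ≡ i

invEntry : ∀ {n} → Permutation′ n → Fin n → ℕ
invEntry {n} w i =
  length (filter (λ j → (w ⟨$⟩ˡ i) <? (w ⟨$⟩ˡ j))
                 (filter (λ j → j <? i) (allFin n)))

inversionSequence : ∀ {n} → Permutation′ n → List ℕ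
inversionSequence {n} w = map (invEntry w) (allFin n)

-- A large ascent at position i: x_i < x_{i+1} but x_{i+1} ≠ x_i + 1.
-- Slow-climbing: no large ascents, i.e. every ascent is a small ascent.
data SlowClimbing : List ℕ → Set where
  sc-[]  : SlowClimbing []
  sc-[_] : ∀ a → SlowClimbing (a ∷ [])
  sc-∷   : ∀ {a b xs} → (a < b → b ≡ suc a) →
           SlowClimbing (b ∷ xs) → SlowClimbing (a ∷ b ∷ xs)

IsSlowlyIncreasing : List ℕ → Set
IsSlowlyIncreasing s = ∃ λ m → (0 < m) × (s ≡ upTo m)

IsConcatOfSlowlyIncreasing : List ℕ → Set
IsConcatOfSlowlyIncreasing x =
  ∃ λ (blocks : List (List ℕ)) → All IsSlowlyIncreasing blocks × (concat blocks ≡ x)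

{-# OPTIONS --safe #-}
-- Extend w⁻¹ = w to an involution σ of ℕ. If σ maps [0, s) into itself, the entries x_t with t ≥ s
-- only count inversions inside [s, t), so shifting by s reduces everything to s = 0. There x_t ≤ t,
-- and the entry at the partner σ 0 is maximal, because every j < σ 0 has σ j > 0 = σ (σ 0). Without
-- large ascents, x_k = k propagates down to every k ≤ σ 0; and x_k = k for 0 < k forces σ k < σ 0,
-- so σ maps [0, σ 0] into itself. Thus (0, …, σ 0) is a slowly increasing block, and the argument
-- restarts after it.
module Submission where

open import Defs
open import Data.Fin as Fin using (Fin; toℕ; fromℕ<)
open import Data.Fin.Permutation using (Permutation′; _⟨$⟩ʳ_; _⟨$⟩ˡ_; inverseˡ)
open import Data.Fin.Properties using (toℕ<n; toℕ-fromℕ<; fromℕ<-toℕ)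
open import Data.List using (List; []; _∷_; _++_; map; filter; length; concat; head; upTo; applyUpTo; tabulate; allFin)
open import Data.List.Properties
  using ( ++-identityʳ; length-map; length-upTo; length-filter; filter-all; filter-none; filter-notAll
        ; filter-++; filter-≐; map-upTo; map-tabulate)
open import Data.List.Relation.Unary.All using (All; []; _∷_)
import Data.List.Relation.Unary.All.Properties as All
open import Data.List.Relation.Unary.Any using (here)
open import Data.List.Relation.Unary.Linked as Linked using (Linked; []; [-]; _∷_)
import Data.List.Relation.Unary.Linked.Properties as Linked
open import Data.Maybe.Base as Maybe using ()
open import Data.Maybe.Relation.Binary.Connected using (Connected; just; just-nothing; nothing-just; nothing)
open import Data.Nat using (ℕ; zero; suc; _+_; _∸_; _≤_; _<_; z≤n; s≤s; z<s; s<s; s≤s⁻¹; _<?_)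
open import Data.Nat.Induction using (<-wellFounded)
open import Data.Nat.Properties
open import Data.Product using (_,_)
open import Data.Sum using (inj₁; inj₂)
open import Function using (_∘_; id)
open import Function.Bundles using (_⇔_; mk⇔; Equivalence)
open import Induction.WellFounded using (Acc; acc)
open import Level using (0ℓ)
open import Relation.Binary using (Rel)
open import Relation.Binary.PropositionalEquality
open import Relation.Nullary using (¬_; yes; no; contradiction)
open import Relation.Nullary.Decidable using (decidable-stable)
open import Relation.Unary using (Pred; Decidable; _≐_)
open import Algebra.Definitions {A = ℕ} _≡_ using (Involutive)

private
  variable
    A B : Set
    m n k : ℕ

filter-map : {P : Pred B 0ℓ} (P? : Decidable P) (f : A → B) (xs : List A) →
             filter P? (map f xs) ≡ map f (filter (P? ∘ f) xs)
filter-map P? f [] = refl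
filter-map P? f (x ∷ xs) with P? (f x)
... | yes _ = cong (f x ∷_) (filter-map P? f xs)
... | no _  = filter-map P? f xs

applyUpTo-+ : (f : ℕ → A) (m k : ℕ) → applyUpTo f (m + k) ≡ applyUpTo f m ++ applyUpTo (f ∘ (m +_)) k
applyUpTo-+ f zero    k = refl
applyUpTo-+ f (suc m) k = cong (f 0 ∷_) (applyUpTo-+ (f ∘ suc) m k)

applyUpTo-cong : {f g : ℕ → A} → (∀ {i} → i < n → f i ≡ g i) → applyUpTo f n ≡ applyUpTo g n
applyUpTo-cong {n = zero}  f≗g = refl
applyUpTo-cong {n = suc n} f≗g = cong₂ _∷_ (f≗g z<s) (applyUpTo-cong (f≗g ∘ s<s))

tabulate≡applyUpTo : {f : Fin n → A} {g : ℕ → A} → (∀ i → f i ≡ g (toℕ i)) → tabulate f ≡ applyUpTo g n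
tabulate≡applyUpTo {n = zero}  f≗g = refl
tabulate≡applyUpTo {n = suc n} f≗g = cong₂ _∷_ (f≗g Fin.zero) (tabulate≡applyUpTo (f≗g ∘ Fin.suc))

map-toℕ-allFin : ∀ n → map toℕ (allFin n) ≡ upTo n
map-toℕ-allFin n = trans (map-tabulate id toℕ) (tabulate≡applyUpTo {g = id} λ _ → refl)

filter-<-upTo : m ≤ n → filter (_<? m) (upTo n) ≡ upTo m
filter-<-upTo {m} m≤n with m≤n⇒∃[o]m+o≡n m≤n
... | k , refl = begin
  filter (_<? m) (upTo (m + k))
    ≡⟨ cong (filter (_<? m)) (applyUpTo-+ id m k) ⟩
  filter (_<? m) (upTo m ++ applyUpTo (m +_) k)
    ≡⟨ filter-++ (_<? m) (upTo m) _ ⟩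
  filter (_<? m) (upTo m) ++ filter (_<? m) (applyUpTo (m +_) k)
    ≡⟨ cong₂ _++_ (filter-all (_<? m) (All.applyUpTo⁺₁ id m id))
                  (filter-none (_<? m) (All.applyUpTo⁺₂ (m +_) k (λ i → ≤⇒≯ (m≤m+n m i)))) ⟩
  upTo m ++ [] ≡⟨ ++-identityʳ (upTo m) ⟩
  upTo m ∎
  where open ≡-Reasoning

Linked-applyUpTo⁻ : {R : Rel A 0ℓ} (f : ℕ → A) → Linked R (applyUpTo f n) →
                    ∀ {i} → suc i < n → R (f i) (f (suc i))
Linked-applyUpTo⁻ {n = suc zero}    f [-]      (s≤s ())
Linked-applyUpTo⁻ {n = suc (suc n)} f (r ∷ rs) {zero}  _ = r
Linked-applyUpTo⁻ {n = suc (suc n)} f (r ∷ rs) {suc i} (s<s i<n) = Linked-applyUpTo⁻ (f ∘ suc) rs i<n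

NoLargeAscent : Rel ℕ 0ℓ
NoLargeAscent a b = a < b → b ≡ suc a

noLargeAscent⇒≤suc : ∀ {a b} → NoLargeAscent a b → b ≤ suc a
noLargeAscent⇒≤suc {a} {b} small with a <? b
... | yes a<b = ≤-reflexive (small a<b)
... | no  a≮b = m≤n⇒m≤1+n (≮⇒≥ a≮b)

slowClimbing⇔linked : ∀ {xs} → SlowClimbing xs ⇔ Linked NoLargeAscent xs
slowClimbing⇔linked = mk⇔ to from
  where
  to : ∀ {xs} → SlowClimbing xs → Linked NoLargeAscent xs
  to sc-[]         = []
  to sc-[ _ ]      = [-]
  to (sc-∷ r rest) = r ∷ to rest
  from : ∀ {xs} → Linked NoLargeAscent xs → SlowClimbing xs
  from []       = sc-[]
  from [-]      = sc-[ _ ]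
  from (r ∷ rs) = sc-∷ r (from rs)

-- Every block starts at 0, so no block boundary is a large ascent.
connected-concat : ∀ {bs} → All IsSlowlyIncreasing bs →
                   ∀ {mx} → Connected NoLargeAscent mx (head (concat bs))
connected-concat []                       {Maybe.just _}  = just-nothing
connected-concat []                       {Maybe.nothing} = nothing
connected-concat ((suc _ , _ , refl) ∷ _) {Maybe.just _}  = just (λ ())
connected-concat ((suc _ , _ , refl) ∷ _) {Maybe.nothing} = nothing-just

linked-concat : ∀ {bs} → All IsSlowlyIncreasing bs → Linked NoLargeAscent (concat bs)
linked-concat []                          = []
linked-concat ((suc m , _ , refl) ∷ sis) =
  Linked.++⁺ (Linked.applyUpTo⁺₂ id (suc m) (λ _ _ → refl)) (connected-concat sis) (linked-concat sis)

concat⇒slowClimbing : ∀ {xs} → IsConcatOfSlowlyIncreasing xs → SlowClimbing xs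
concat⇒slowClimbing (_ , sis , refl) = Equivalence.from slowClimbing⇔linked (linked-concat sis)

ClimbsSlowly : (ℕ → ℕ) → ℕ → Set
ClimbsSlowly f n = ∀ {t} → suc t < n → f (suc t) ≤ suc (f t)

climbsSlowly-fixed-downwards : ∀ {f L} → (∀ t → f t ≤ t) → ClimbsSlowly f (suc L) → f L ≡ L →
                               ∀ {k} → k ≤ L → f k ≡ k
climbsSlowly-fixed-downwards {L = zero}  below climbs fL≡L z≤n = fL≡L
climbsSlowly-fixed-downwards {f} {L = suc L} below climbs fL≡L k≤L with m≤n⇒m<n∨m≡n k≤L
... | inj₂ refl = fL≡L
... | inj₁ k<L  = climbsSlowly-fixed-downwards below (climbs ∘ m<n⇒m<1+n) fL'≡L' (s≤s⁻¹ k<L)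
  where
  fL'≡L' : f L ≡ L
  fL'≡L' = ≤-antisym (below L) (s≤s⁻¹ (subst (_≤ suc (f L)) fL≡L (climbs ≤-refl)))

inversionCount : (ℕ → ℕ) → ℕ → ℕ
inversionCount σ t = length (filter (λ j → σ t <? σ j) (upTo t))

ClosedBelow : (ℕ → ℕ) → ℕ → Set
ClosedBelow σ m = ∀ {j} → j < m → σ j < m

shift : (ℕ → ℕ) → ℕ → ℕ → ℕ
shift σ m k = σ (m + k) ∸ m

module _ {σ : ℕ → ℕ} (σ-involutive : Involutive σ) where

  closedBelow⇒≥ : ClosedBelow σ m → ∀ {t} → m ≤ t → m ≤ σ t
  closedBelow⇒≥ {m} closed {t} m≤t =
    ≮⇒≥ (λ σt<m → <⇒≱ (subst (_< m) (σ-involutive t) (closed σt<m)) m≤t)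

  inversionCount-≤ : ∀ t → inversionCount σ t ≤ t
  inversionCount-≤ t = ≤-trans (length-filter _ (upTo t)) (≤-reflexive (length-upTo t))

  inversionCount-partner : inversionCount σ (σ 0) ≡ σ 0
  inversionCount-partner =
    trans (cong length (filter-all _ (All.applyUpTo⁺₁ id (σ 0) above))) (length-upTo (σ 0))
    where
    above : ∀ {j} → j < σ 0 → σ (σ 0) < σ j
    above {j} j<σ0 = subst (_< σ j) (sym (σ-involutive 0)) (n≢0⇒n>0 λ σj≡0 →
      <-irrefl (trans (sym (σ-involutive j)) (cong σ σj≡0)) j<σ0)

  inversionCount-full⇒<first : ∀ {i} → inversionCount σ (suc i) ≡ suc i → σ (suc i) < σ 0
  inversionCount-full⇒<first {i} full = decidable-stable (σ (suc i) <? σ 0) λ ≮σ0 →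
    <-irrefl (trans full (sym (length-upTo (suc i))))
             (filter-notAll (λ j → σ (suc i) <? σ j) (upTo (suc i)) (here ≮σ0))

  inversionCount-firstBlock : ClimbsSlowly (inversionCount σ) (suc (σ 0)) →
                              ∀ {k} → k ≤ σ 0 → inversionCount σ k ≡ k
  inversionCount-firstBlock climbs = climbsSlowly-fixed-downwards inversionCount-≤ climbs inversionCount-partner

  firstBlock-closedBelow : ClimbsSlowly (inversionCount σ) (suc (σ 0)) → ClosedBelow σ (suc (σ 0))
  firstBlock-closedBelow climbs {zero}  _       = ≤-refl
  firstBlock-closedBelow climbs {suc i} i<σ0+1 =
    m<n⇒m<1+n (inversionCount-full⇒<first (inversionCount-firstBlock climbs (s≤s⁻¹ i<σ0+1)))

  module _ (closed : ClosedBelow σ m) where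

    shift-involutive : Involutive (shift σ m)
    shift-involutive k = begin
      σ (m + (σ (m + k) ∸ m)) ∸ m
        ≡⟨ cong (λ i → σ i ∸ m) (m+[n∸m]≡n (closedBelow⇒≥ closed (m≤m+n m k))) ⟩
      σ (σ (m + k)) ∸ m           ≡⟨ cong (_∸ m) (σ-involutive (m + k)) ⟩
      m + k ∸ m                   ≡⟨ m+n∸m≡n m k ⟩
      k                           ∎
      where open ≡-Reasoning

    shift-closedBelow : ClosedBelow σ (m + k) → ClosedBelow (shift σ m) k
    shift-closedBelow {k} closedᵏ {i} i<k = subst (σ (m + i) ∸ m <_) (m+n∸m≡n m k)
      (∸-monoˡ-< (closedᵏ (+-monoʳ-< m i<k)) (closedBelow⇒≥ closed (m≤m+n m i)))

    -- Indices below m cannot contribute, since σ maps them below m ≤ σ (m + k).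
    shift-inversionCount : ∀ k → inversionCount (shift σ m) k ≡ inversionCount σ (m + k)
    shift-inversionCount k = sym (begin
      length (filter P? (upTo (m + k)))
        ≡⟨ cong (length ∘ filter P?) (applyUpTo-+ id m k) ⟩
      length (filter P? (upTo m ++ applyUpTo (m +_) k))
        ≡⟨ cong length (filter-++ P? (upTo m) _) ⟩
      length (filter P? (upTo m) ++ filter P? (applyUpTo (m +_) k))
        ≡⟨ cong (λ ys → length (ys ++ filter P? (applyUpTo (m +_) k)))
                (filter-none P? (All.applyUpTo⁺₁ id m below)) ⟩
      length (filter P? (applyUpTo (m +_) k))
        ≡⟨ cong (length ∘ filter P?) (sym (map-upTo (m +_) k)) ⟩
      length (filter P? (map (m +_) (upTo k)))
        ≡⟨ cong length (filter-map P? (m +_) (upTo k)) ⟩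
      length (map (m +_) (filter (P? ∘ (m +_)) (upTo k)))
        ≡⟨ length-map (m +_) (filter (P? ∘ (m +_)) (upTo k)) ⟩
      length (filter (P? ∘ (m +_)) (upTo k))
        ≡⟨ cong length (filter-≐ _ _ shifted (upTo k)) ⟩
      inversionCount (shift σ m) k ∎)
      where
      open ≡-Reasoning
      P? : Decidable (λ j → σ (m + k) < σ j)
      P? j = σ (m + k) <? σ j
      below : ∀ {j} → j < m → ¬ σ (m + k) < σ j
      below j<m = ≤⇒≯ (≤-trans (<⇒≤ (closed j<m)) (closedBelow⇒≥ closed (m≤m+n m k)))
      shifted : (λ i → σ (m + k) < σ (m + i)) ≐ (λ i → shift σ m k < shift σ m i)
      shifted = (λ lt → ∸-monoˡ-< lt (closedBelow⇒≥ closed (m≤m+n m k)))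
              , (λ lt → ≰⇒> (λ ≥ → <⇒≱ lt (∸-monoˡ-≤ m ≥)))

    shift-climbsSlowly : ClimbsSlowly (inversionCount σ) (m + k) → ClimbsSlowly (inversionCount (shift σ m)) k
    shift-climbsSlowly {k} climbs {t} t+1<k
      rewrite shift-inversionCount (suc t) | shift-inversionCount t | +-suc m t
      = climbs (subst (_< m + k) (+-suc m t) (+-monoʳ-< m t+1<k))

climbsSlowly⇒concat : (σ : ℕ → ℕ) → Involutive σ → Acc _<_ n → ClosedBelow σ n →
                      ClimbsSlowly (inversionCount σ) n → IsConcatOfSlowlyIncreasing (applyUpTo (inversionCount σ) n)
climbsSlowly⇒concat {zero}  σ σ-involutive _         _      _      = [] , [] , refl
climbsSlowly⇒concat {suc n} σ σ-involutive (acc rec) closed climbs with m≤n⇒∃[o]m+o≡n (closed z<s)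
... | k , refl = prependFirstBlock
  (climbsSlowly⇒concat (shift σ l) (shift-involutive σ-involutive closedˡ) (rec (s≤s (m≤n+m k (σ 0))))
                       (shift-closedBelow σ-involutive closedˡ closed) (shift-climbsSlowly σ-involutive closedˡ climbs))
  where
  l : ℕ
  l = suc (σ 0)
  climbsˡ : ClimbsSlowly (inversionCount σ) l
  climbsˡ t+1<l = climbs (<-≤-trans t+1<l (m≤m+n l k))
  closedˡ : ClosedBelow σ l
  closedˡ = firstBlock-closedBelow σ-involutive climbsˡ
  prependFirstBlock : IsConcatOfSlowlyIncreasing (applyUpTo (inversionCount (shift σ l)) k) →
                      IsConcatOfSlowlyIncreasing (applyUpTo (inversionCount σ) (l + k))
  prependFirstBlock (blocks , blocks-slowlyIncreasing , concat-blocks) =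
    upTo l ∷ blocks , (l , z<s , refl) ∷ blocks-slowlyIncreasing , (begin
    upTo l ++ concat blocks
      ≡⟨ cong₂ _++_ (sym (applyUpTo-cong (inversionCount-firstBlock σ-involutive climbsˡ ∘ s≤s⁻¹)))
                    concat-blocks ⟩
    applyUpTo (inversionCount σ) l ++ applyUpTo (inversionCount (shift σ l)) k
      ≡⟨ cong (applyUpTo (inversionCount σ) l ++_)
              (applyUpTo-cong (λ {i} _ → shift-inversionCount σ-involutive closedˡ i)) ⟩
    applyUpTo (inversionCount σ) l ++ applyUpTo (inversionCount σ ∘ (l +_)) k
      ≡⟨ sym (applyUpTo-+ (inversionCount σ) l k) ⟩
    applyUpTo (inversionCount σ) (l + k) ∎)
    where open ≡-Reasoning

slowClimbing⇔concat : {σ : ℕ → ℕ} → Involutive σ → ClosedBelow σ n →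
                      SlowClimbing (applyUpTo (inversionCount σ) n) ⇔
                      IsConcatOfSlowlyIncreasing (applyUpTo (inversionCount σ) n)
slowClimbing⇔concat {n} {σ} σ-involutive closed = mk⇔
  (λ sc → climbsSlowly⇒concat σ σ-involutive (<-wellFounded n) closed λ t+1<n →
    noLargeAscent⇒≤suc (Linked-applyUpTo⁻ (inversionCount σ) (Equivalence.to slowClimbing⇔linked sc) t+1<n))
  concat⇒slowClimbing

-- The identity beyond n, so that involutions of Fin n extend to involutions of ℕ.
extendℕ : (Fin n → Fin n) → ℕ → ℕ
extendℕ {n} π k with k <? n
... | yes k<n = toℕ (π (fromℕ< k<n))
... | no  _   = k

extendℕ-toℕ : (π : Fin n → Fin n) (i : Fin n) → extendℕ π (toℕ i) ≡ toℕ (π i)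
extendℕ-toℕ {n} π i with toℕ i <? n
... | yes i<n = cong (toℕ ∘ π) (fromℕ<-toℕ i i<n)
... | no  i≮n = contradiction (toℕ<n i) i≮n

extendℕ-closedBelow : (π : Fin n → Fin n) → ClosedBelow (extendℕ π) n
extendℕ-closedBelow {n} π {k} k<n with k <? n
... | yes _   = toℕ<n _
... | no  k≮n = contradiction k<n k≮n

extendℕ-involutive : {π : Fin n → Fin n} → (∀ i → π (π i) ≡ i) → Involutive (extendℕ π)
extendℕ-involutive {n} {π} π-involutive k with k <? n
... | yes k<n = begin
  extendℕ π (toℕ (π (fromℕ< k<n))) ≡⟨ extendℕ-toℕ π (π (fromℕ< k<n)) ⟩
  toℕ (π (π (fromℕ< k<n)))         ≡⟨ cong toℕ (π-involutive (fromℕ< k<n)) ⟩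
  toℕ (fromℕ< k<n)                 ≡⟨ toℕ-fromℕ< k<n ⟩
  k                                 ∎
  where open ≡-Reasoning
... | no k≮n with k <? n
...   | yes k<n = contradiction k<n k≮n
...   | no  _   = refl

module _ (w : Permutation′ n) where

  private
    σ : ℕ → ℕ
    σ = extendℕ (w ⟨$⟩ˡ_)

  invEntry≡inversionCount : ∀ i → invEntry w i ≡ inversionCount σ (toℕ i)
  invEntry≡inversionCount i = begin
    length (filter (λ j → w ⟨$⟩ˡ i Fin.<? w ⟨$⟩ˡ j) earlier)
      ≡⟨ cong length (filter-≐ _ (P? ∘ toℕ) lifted earlier) ⟩
    length (filter (P? ∘ toℕ) earlier)
      ≡⟨ sym (length-map toℕ (filter (P? ∘ toℕ) earlier)) ⟩
    length (map toℕ (filter (P? ∘ toℕ) earlier))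
      ≡⟨ cong length (sym (filter-map P? toℕ earlier)) ⟩
    length (filter P? (map toℕ earlier))
      ≡⟨ cong (length ∘ filter P?) toℕ-earlier ⟩
    length (filter P? (upTo (toℕ i))) ∎
    where
    open ≡-Reasoning
    earlier : List (Fin n)
    earlier = filter (Fin._<? i) (allFin n)
    P? : Decidable (λ k → σ (toℕ i) < σ k)
    P? k = σ (toℕ i) <? σ k
    lifted : (λ j → w ⟨$⟩ˡ i Fin.< w ⟨$⟩ˡ j) ≐ (λ j → σ (toℕ i) < σ (toℕ j))
    lifted = subst₂ _<_ (sym (extendℕ-toℕ _ i)) (sym (extendℕ-toℕ _ _))
           , subst₂ _<_ (extendℕ-toℕ _ i) (extendℕ-toℕ _ _)
    toℕ-earlier : map toℕ earlier ≡ upTo (toℕ i)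
    toℕ-earlier = begin
      map toℕ earlier                        ≡⟨ sym (filter-map (_<? toℕ i) toℕ (allFin n)) ⟩
      filter (_<? toℕ i) (map toℕ (allFin n)) ≡⟨ cong (filter (_<? toℕ i)) (map-toℕ-allFin n) ⟩
      filter (_<? toℕ i) (upTo n)            ≡⟨ filter-<-upTo (<⇒≤ (toℕ<n i)) ⟩
      upTo (toℕ i)                           ∎

  inversionSequence≡applyUpTo : inversionSequence w ≡ applyUpTo (inversionCount σ) n
  inversionSequence≡applyUpTo =
    trans (map-tabulate id (invEntry w)) (tabulate≡applyUpTo invEntry≡inversionCount)

  inverse-involutive : IsInvolution w → ∀ i → w ⟨$⟩ˡ (w ⟨$⟩ˡ i) ≡ i
  inverse-involutive w-involutive i = begin
    w ⟨$⟩ˡ (w ⟨$⟩ˡ i)                   ≡⟨ cong (λ j → w ⟨$⟩ˡ (w ⟨$⟩ˡ j)) (sym (w-involutive i)) ⟩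
    w ⟨$⟩ˡ (w ⟨$⟩ˡ (w ⟨$⟩ʳ (w ⟨$⟩ʳ i))) ≡⟨ cong (w ⟨$⟩ˡ_) (inverseˡ w) ⟩
    w ⟨$⟩ˡ (w ⟨$⟩ʳ i)                   ≡⟨ inverseˡ w ⟩
    i                                   ∎
    where open ≡-Reasoning

lemma5p3 : (n : ℕ) (w : Permutation′ n) → IsInvolution w →
           SlowClimbing (inversionSequence w) ⇔ IsConcatOfSlowlyIncreasing (inversionSequence w)
lemma5p3 n w w-involutive =
  subst (λ xs → SlowClimbing xs ⇔ IsConcatOfSlowlyIncreasing xs) (sym (inversionSequence≡applyUpTo w))
    (slowClimbing⇔concat (extendℕ-involutive (inverse-involutive w w-involutive))
                         (extendℕ-closedBelow (w ⟨$⟩ˡ_)))
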